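{- Let $G$ be an almost hypohamiltonian graph containing a triangle $T$. Then every vertex of $T$ has degree at least $4$ in $G$.
   Context: Graphs are finite, simple, undirected and connected. A graph is hamiltonian if it has a cycle through all vertices. A graph $G$ is almost hypohamiltonian if $G$ is non-hamiltonian and there is a vertex $w$ (the exceptional vertex) such that $G - w$ is non-hamiltonian but $G - v$ is hamiltonian for every vertex $v \ne w$. -}

module Defs where

open import Data.Nat using (ℕ; zero; suc; _≤_)
open import Data.Bool using (Bool; true; false; T)
open import Data.Fin using (Fin; punchIn)
open import Data.List using (List; []; _∷_; _++_; [_]; length; filter; allFin)
open import Data.List.Relation.Unary.Linked using (Linked)
open import Data.List.Relation.Unary.Unique.Propositional using (Unique)
open import Data.List.Membership.Propositional using (_∈_)
open import Data.Product using (Σ; _×_; ∃)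
open import Relation.Nullary using (¬_)
open import Relation.Nullary.Decidable using (T?)
open import Relation.Binary.PropositionalEquality using (_≡_)

record Graph (n : ℕ) : Set where
  field
    adj   : Fin n → Fin n → Bool
    sym   : ∀ u v → adj u v ≡ adj v u
    irrefl : ∀ v → adj v v ≡ false

open Graph public

Adj : ∀ {n} → Graph n → Fin n → Fin n → Set
Adj G u v = T (adj G u v)

data Reachable {n} (G : Graph n) : Fin n → Fin n → Set where
  here : ∀ {v} → Reachable G v v
  step : ∀ {u w v} → Adj G u w → Reachable G w v → Reachable G u v

Connected : ∀ {n} → Graph n → Set
Connected {n} G = ∀ (u v : Fin n) → Reachable G u v

degree : ∀ {n} → Graph n → Fin n → ℕ
degree {n} G v = length (filter (λ w → T? (adj G v w)) (allFin n))

-- A hamiltonian cycle, written as x ∷ xs: the vertices x, xs are pairwise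
-- distinct, cover all vertices, there are at least 3 of them, and
-- x, xs..., x is a walk (consecutive vertices adjacent, last adjacent to x).
record HamCycle {n} (G : Graph n) : Set where
  field
    start   : Fin n
    rest    : List (Fin n)
    long    : 2 ≤ length rest
    distinct : Unique (start ∷ rest)
    covers  : ∀ v → v ∈ start ∷ rest
    closed  : Linked (Adj G) (start ∷ rest ++ [ start ])

Hamiltonian : ∀ {n} → Graph n → Set
Hamiltonian G = HamCycle G

-- vertex deletion G - v; the remaining vertices are relabelled by punchIn v
delete : ∀ {n} → Graph (suc n) → Fin (suc n) → Graph n
delete G v = record
  { adj = λ a b → adj G (punchIn v a) (punchIn v b)
  ; sym = λ a b → sym G (punchIn v a) (punchIn v b)
  ; irrefl = λ a → irrefl G (punchIn v a)
  }

AlmostHypohamiltonian : ∀ {n} → Graph (suc n) → Set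
AlmostHypohamiltonian {n} G =
  ¬ Hamiltonian G ×
  Σ (Fin (suc n)) λ w →
    ¬ Hamiltonian (delete G w) ×
    (∀ v → ¬ v ≡ w → Hamiltonian (delete G v))

module Submission where

open import Defs hiding (sym)
open import Data.Nat using (ℕ; suc; _≤_; s≤s; z≤n)
open import Data.Nat.Properties using (+-comm)
open import Data.Fin using (Fin; punchIn; punchOut; _≟_)
open import Data.Fin.Properties using (punchIn-injective; punchInᵢ≢i; punchIn-punchOut)
open import Data.Product using (_×_; _,_; ∃; proj₂)
open import Data.Sum using (inj₁; inj₂)
open import Data.Empty using (⊥-elim)
open import Data.Bool using (T)
open import Data.List using (List; []; _∷_; _++_; [_]; _∷ʳ_; length; map; initLast; _∷ʳ′_)
open import Data.List.Properties using (length-++-sucʳ; length-++; map-++; ++-assoc)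
open import Data.List.Relation.Unary.Linked using (Linked; [-]; _∷_)
import Data.List.Relation.Unary.Linked.Properties as Linked
open import Data.List.Relation.Unary.All using (All; []; _∷_)
import Data.List.Relation.Unary.All as All
import Data.List.Relation.Unary.All.Properties as All
open import Data.List.Relation.Unary.AllPairs using ([]; _∷_)
open import Data.List.Relation.Unary.Any using (here; there)
open import Data.List.Relation.Unary.Unique.Propositional using (Unique)
import Data.List.Relation.Unary.Unique.Propositional.Properties as Unique
open import Data.List.Membership.Propositional using (_∈_)
open import Data.List.Membership.Propositional.Properties using (∈-filter⁺; ∈-allFin; ∈-++⁻; ∈-++⁺ˡ; ∈-++⁺ʳ; ∈-∃++; ∈-map⁺)
open import Data.List.Relation.Binary.Subset.Propositional using (_⊆_)
open import Relation.Nullary using (¬_; yes; no)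
open import Relation.Nullary.Decidable using (T?)
open import Relation.Binary.PropositionalEquality using (_≡_; _≢_; refl; sym; trans; subst; ≢-sym)

-- The vertex y of a triangle xyz that is not the exceptional vertex leaves a
-- hamiltonian graph G - y.  On a hamiltonian cycle of G - y the vertex x has two
-- neighbours; if one of them were z, inserting y between x and z would give a
-- hamiltonian cycle of G.  So x is adjacent to y, z and two further vertices.

Unique⇒length≤ : ∀ {A : Set} {xs ys : List A} → Unique xs → xs ⊆ ys → length xs ≤ length ys
Unique⇒length≤ {xs = []} _ _ = z≤n
Unique⇒length≤ {xs = x ∷ xs} (x∉xs ∷ xs-unique) xs⊆ys with ∈-∃++ (xs⊆ys (here refl))
... | A , B , refl =
  subst (suc (length xs) ≤_) (sym (length-++-sucʳ A x B))
    (s≤s (Unique⇒length≤ xs-unique xs⊆A++B))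
  where
  xs⊆A++B : xs ⊆ A ++ B
  xs⊆A++B v∈xs with ∈-++⁻ A (xs⊆ys (there v∈xs))
  ... | inj₁ v∈A          = ∈-++⁺ˡ v∈A
  ... | inj₂ (here refl)  = ⊥-elim (All.lookup x∉xs v∈xs refl)
  ... | inj₂ (there v∈B)  = ∈-++⁺ʳ A v∈B

Unique-rotate : ∀ {A : Set} {x : A} (xs : List A) → Unique (x ∷ xs) → Unique (xs ∷ʳ x)
Unique-rotate [] _ = [] ∷ []
Unique-rotate (y ∷ xs) ((x≢y ∷ x∉xs) ∷ y∉xs ∷ xs-unique) =
  All.++⁺ y∉xs (≢-sym x≢y ∷ []) ∷ Unique-rotate xs (x∉xs ∷ xs-unique)

Linked-∷ʳ : ∀ {A : Set} {R : A → A → Set} (xs : List A) {a b : A} →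
  Linked R (xs ∷ʳ a) → R a b → Linked R (xs ∷ʳ a ∷ʳ b)
Linked-∷ʳ [] _ Rab = Rab ∷ [-]
Linked-∷ʳ (x ∷ []) (Rxa ∷ _) Rab = Rxa ∷ Rab ∷ [-]
Linked-∷ʳ (x ∷ y ∷ xs) (Rxy ∷ rest) Rab = Rxy ∷ Linked-∷ʳ (y ∷ xs) rest Rab

-- HamCycle over an arbitrary relation, with the start and the rest as indices so that
-- rotations of a cycle can be stated.
record IsHamCycle {A : Set} (R : A → A → Set) (s : A) (rs : List A) : Set where
  field
    long     : 2 ≤ length rs
    distinct : Unique (s ∷ rs)
    covers   : ∀ v → v ∈ s ∷ rs
    closed   : Linked R (s ∷ rs ++ [ s ])

open IsHamCycle

module _ {A : Set} {R : A → A → Set} where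

  rotate₁ : ∀ {s r rs} → IsHamCycle R s (r ∷ rs) → IsHamCycle R r (rs ∷ʳ s)
  rotate₁ {s} {r} {rs} c = record
    { long     = subst (2 ≤_) (sym (trans (length-++ rs) (+-comm (length rs) 1))) (long c)
    ; distinct = Unique-rotate (r ∷ rs) (distinct c)
    ; covers   = λ v → r∷rs⊆ (covers c v)
    ; closed   = closed′ (closed c)
    }
    where
    r∷rs⊆ : s ∷ r ∷ rs ⊆ r ∷ rs ∷ʳ s
    r∷rs⊆ (here v≡s) = ∈-++⁺ʳ (r ∷ rs) (here v≡s)
    r∷rs⊆ (there v∈) = ∈-++⁺ˡ v∈
    closed′ : Linked R (s ∷ r ∷ rs ∷ʳ s) → Linked R (r ∷ rs ∷ʳ s ∷ʳ r)
    closed′ (Rsr ∷ walk) = Linked-∷ʳ (r ∷ rs) walk Rsr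

  rotate : ∀ {s x} (as : List A) {bs} → IsHamCycle R s (as ++ x ∷ bs) → IsHamCycle R x (bs ++ s ∷ as)
  rotate [] c = rotate₁ c
  rotate {s} {x} (a ∷ as) {bs} c =
    subst (IsHamCycle R x) (++-assoc bs [ s ] (a ∷ as))
      (rotate as (subst (IsHamCycle R a) (++-assoc as (x ∷ bs) [ s ]) (rotate₁ c)))

  startingAt : ∀ {s rs} → IsHamCycle R s rs → ∀ x → ∃ (IsHamCycle R x)
  startingAt c x with ∈-∃++ (covers c x)
  ... | [] , bs , refl = bs , c
  ... | a ∷ as , bs , refl = bs ++ a ∷ as , rotate as c

  successor-adj : ∀ {s r rs} → IsHamCycle R s (r ∷ rs) → R s r
  successor-adj c with closed c
  ... | Rsr ∷ _ = Rsr

  predecessor-adj : ∀ {s q} rs → IsHamCycle R s (rs ∷ʳ q) → R q s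
  predecessor-adj rs c = successor-adj (rotate rs c)

  successor≢predecessor : ∀ {s r q} rs → IsHamCycle R s (r ∷ rs ∷ʳ q) → r ≢ q
  successor≢predecessor rs c with distinct c
  ... | _ ∷ r∉rs∷ʳq ∷ _ = All.lookup r∉rs∷ʳq (∈-++⁺ʳ rs (here refl))

toIsHamCycle : ∀ {n} {G : Graph n} (H : HamCycle G) → IsHamCycle (Adj G) (HamCycle.start H) (HamCycle.rest H)
toIsHamCycle H = record
  { long = HamCycle.long H ; distinct = HamCycle.distinct H
  ; covers = HamCycle.covers H ; closed = HamCycle.closed H }

fromIsHamCycle : ∀ {n} {G : Graph n} {s rs} → IsHamCycle (Adj G) s rs → Hamiltonian G
fromIsHamCycle {s = s} {rs} c = record
  { start = s ; rest = rs ; long = long c ; distinct = distinct c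
  ; covers = covers c ; closed = closed c }

Adj-irrefl : ∀ {n} (G : Graph n) {u v : Fin n} → Adj G u v → u ≢ v
Adj-irrefl G {u} Auv refl with subst T (irrefl G u) Auv
... | ()

Adj-sym : ∀ {n} (G : Graph n) {u v : Fin n} → Adj G u v → Adj G v u
Adj-sym G {u} {v} = subst T (Graph.sym G u v)

length≤degree : ∀ {n} (G : Graph n) {x : Fin n} {vs : List (Fin n)} →
  Unique vs → All (Adj G x) vs → length vs ≤ degree G x
length≤degree G {x} vs-unique vs-adj =
  Unique⇒length≤ vs-unique (λ {v} v∈vs → ∈-filter⁺ (λ w → T? (adj G x w)) (∈-allFin v) (All.lookup vs-adj v∈vs))

hamiltonian-by-insertion : ∀ {n} (G : Graph (suc n)) (y : Fin (suc n)) {u v : Fin n} {rs : List (Fin n)} →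
  Adj G (punchIn y u) y → Adj G y (punchIn y v) →
  IsHamCycle (Adj (delete G y)) u (v ∷ rs) → Hamiltonian G
hamiltonian-by-insertion {n} G y {u} {v} {rs} Auy Ayv c = fromIsHamCycle {G = G} record
  { long     = s≤s (s≤s z≤n)
  ; distinct = distinct′ (Unique.map⁺ (λ {a} {b} → punchIn-injective y a b) (distinct c))
  ; covers   = covers′
  ; closed   = Auy ∷ Ayv ∷ closed′ (closed c)
  }
  where
  ↑ : Fin n → Fin (suc n)
  ↑ = punchIn y
  y∉↑ : ∀ xs → All (y ≢_) (map ↑ xs)
  y∉↑ [] = []
  y∉↑ (x ∷ xs) = ≢-sym (punchInᵢ≢i y x) ∷ y∉↑ xs
  distinct′ : Unique (map ↑ (u ∷ v ∷ rs)) → Unique (↑ u ∷ y ∷ map ↑ (v ∷ rs))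
  distinct′ (↑u∉ ∷ rest) = (punchInᵢ≢i y u ∷ ↑u∉) ∷ y∉↑ (v ∷ rs) ∷ rest
  covers′ : ∀ w → w ∈ ↑ u ∷ y ∷ map ↑ (v ∷ rs)
  covers′ w with y ≟ w
  ... | yes refl = there (here refl)
  ... | no y≢w with subst (_∈ map ↑ (u ∷ v ∷ rs)) (punchIn-punchOut y≢w) (∈-map⁺ ↑ (covers c (punchOut y≢w)))
  ...   | here w≡↑u = here w≡↑u
  ...   | there w∈  = there (there w∈)
  closed′ : Linked (Adj (delete G y)) (u ∷ v ∷ rs ∷ʳ u) → Linked (Adj G) (↑ v ∷ map ↑ rs ∷ʳ ↑ u)
  closed′ (_ ∷ walk) = subst (λ ws → Linked (Adj G) (↑ v ∷ ws)) (map-++ ↑ rs [ u ]) (Linked.map⁺ walk)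

degree-at-cycle-start : ∀ {n} (G : Graph (suc n)) {y z : Fin (suc n)} {x : Fin n} {rs : List (Fin n)} →
  ¬ Hamiltonian G → Adj G (punchIn y x) y → Adj G y z → Adj G (punchIn y x) z →
  IsHamCycle (Adj (delete G y)) x rs → 4 ≤ degree G (punchIn y x)
degree-at-cycle-start G {rs = []} _ _ _ _ c with long c
... | ()
degree-at-cycle-start G {rs = r ∷ rs} ¬ham xy yz xz c with initLast rs
... | [] with long c
...   | s≤s ()
degree-at-cycle-start G {y} {z} {rs = r ∷ _} ¬ham xy yz xz c | M ∷ʳ′ q
  with punchIn y r ≟ z | punchIn y q ≟ z
... | yes refl | _ = ⊥-elim (¬ham (hamiltonian-by-insertion G y xy yz c))
... | _ | yes refl =
  -- read from q, the cycle is q ∷ x ∷ …, so y goes between q = z and x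
  ⊥-elim (¬ham (hamiltonian-by-insertion G y (Adj-sym G yz) (Adj-sym G xy) (rotate (r ∷ M) c)))
... | no ↑r≢z | no ↑q≢z =
  length≤degree G
    ((y≢z ∷ y≢↑ r ∷ y≢↑ q ∷ []) ∷ (≢-sym ↑r≢z ∷ ≢-sym ↑q≢z ∷ []) ∷ (↑r≢↑q ∷ []) ∷ [] ∷ [])
    (xy ∷ xz ∷ successor-adj c ∷ Adj-sym G (predecessor-adj (r ∷ M) c) ∷ [])
  where
  y≢z : y ≢ z
  y≢z = Adj-irrefl G yz
  y≢↑ : ∀ v → y ≢ punchIn y v
  y≢↑ v = ≢-sym (punchInᵢ≢i y v)
  ↑r≢↑q : punchIn y r ≢ punchIn y q
  ↑r≢↑q ↑r≡↑q = successor≢predecessor M c (punchIn-injective y r q ↑r≡↑q)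

triangle-degree : ∀ {n} (G : Graph (suc n)) {x y z : Fin (suc n)} → ¬ Hamiltonian G → Hamiltonian (delete G y) →
  Adj G x y → Adj G y z → Adj G x z → 4 ≤ degree G x
triangle-degree G {x} {y} ¬ham H xy yz xz =
  subst (λ v → 4 ≤ degree G v) ↑x′≡x
    (degree-at-cycle-start G ¬ham (lift xy) yz (lift xz) (proj₂ (startingAt (toIsHamCycle H) x′)))
  where
  y≢x : y ≢ x
  y≢x = Adj-irrefl G (Adj-sym G xy)
  x′ : Fin _
  x′ = punchOut y≢x
  ↑x′≡x : punchIn y x′ ≡ x
  ↑x′≡x = punchIn-punchOut y≢x
  lift : ∀ {v} → Adj G x v → Adj G (punchIn y x′) v
  lift = subst (λ u → Adj G u _) (sym ↑x′≡x)

-- Of the two other triangle vertices y and z, at most one is the exceptional vertex.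
almostHypohamiltonian-triangle-degree : ∀ {n} (G : Graph (suc n)) → AlmostHypohamiltonian G →
  {x y z : Fin (suc n)} → Adj G x y → Adj G y z → Adj G x z → 4 ≤ degree G x
almostHypohamiltonian-triangle-degree G (¬ham , w , _ , ham-delete) {y = y} {z} xy yz xz with y ≟ w
... | no y≢w = triangle-degree G ¬ham (ham-delete y y≢w) xy yz xz
... | yes refl = triangle-degree G ¬ham (ham-delete z (≢-sym (Adj-irrefl G yz))) xz (Adj-sym G yz) xy

lemma3p5 : (n : ℕ) (G : Graph (suc n)) → Connected G → AlmostHypohamiltonian G →
    (a b c : Fin (suc n)) → Adj G a b → Adj G b c → Adj G a c →
    (4 ≤ degree G a) × (4 ≤ degree G b) × (4 ≤ degree G c)
lemma3p5 n G _ ah a b c ab bc ac =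
  almostHypohamiltonian-triangle-degree G ah ab bc ac ,
  almostHypohamiltonian-triangle-degree G ah (Adj-sym G ab) ac bc ,
  almostHypohamiltonian-triangle-degree G ah (Adj-sym G ac) ab (Adj-sym G bc)
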